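{- Let $T$ and $T^*$ be rooted phylogenetic trees with the same leaf set $L$ such that $T^*$ is a refinement of $T$. Then the partition $\mathcal{L}(T^*)=\{L^{T^*}_v\mid v\in V^0(T^*)\}$ is a refinement of the partition $\mathcal{L}(T)=\{L^{T}_v\mid v\in V^0(T)\}$, i.e., for every $u^*\in V^0(T^*)$ there is $w\in V^0(T)$ with $L^{T^*}_{u^*}\subseteq L^T_w$.
   Context: A rooted tree is phylogenetic if every inner vertex has at least two children; $V^0(T)$ denotes the set of inner vertices of $T$. $\operatorname{lca}_T(x,y)$ is the last common ancestor of $x,y$ in $T$. For $v\in V(T)$, $L^T_v=\{(x,y)\mid x,y\in L(T),\ \operatorname{lca}_T(x,y)=v\}$; for phylogenetic $T$, the sets $L^T_v$, $v\in V^0(T)$, are nonempty, pairwise disjoint and partition the set of ordered pairs of distinct leaves. $\mathcal{H}(T)=\{L(T(u))\mid u\in V(T)\}$ where $L(T(u))$ is the set of leaves below $u$; $T^*$ is a refinement of $T$ (same leaf set) iff $\mathcal{H}(T)\subseteq\mathcal{H}(T^*)$. -}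

module Defs where

open import Data.Nat using (ℕ; _≤_)
open import Data.List using (List; length; lookup)
open import Data.Fin using (Fin)
open import Data.Product using (Σ; ∃; _×_; _,_)
open import Relation.Binary.PropositionalEquality using (_≡_)
open import Function.Bundles using (_⇔_)

-- Rooted trees with leaves labelled by elements of A.
-- A vertex is either a leaf (carrying its label) or an inner vertex
-- with an (ordered, irrelevant) list of children.
data Tree (A : Set) : Set where
  leaf : A → Tree A
  node : List (Tree A) → Tree A

module _ {A : Set} where

  -- Vertices of a tree, given as positions (paths from the root).
  data Pos : Tree A → Set where
    root : ∀ {t} → Pos t
    down : ∀ {ts} (i : Fin (length ts)) → Pos (lookup ts i) → Pos (node ts)

  sub : ∀ {t} → Pos t → Tree A
  sub {t} root = t
  sub (down i p) = sub p

  -- Ancestor relation: u ≼ v iff v lies in the subtree rooted at u (v ⪯ u).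
  data _≼_ : ∀ {t} → Pos t → Pos t → Set where
    root≼ : ∀ {t} {p : Pos t} → root ≼ p
    down≼ : ∀ {ts} {i : Fin (length ts)} {p q : Pos (lookup ts i)} →
            p ≼ q → down {ts = ts} i p ≼ down i q

  Inner : ∀ {t} → Pos t → Set
  Inner p = ∃ λ ts → sub p ≡ node ts

  _∈L_ : A → Tree A → Set
  x ∈L t = Σ (Pos t) λ q → sub q ≡ leaf x

  -- Rooted phylogenetic tree: every inner vertex has at least two children,
  -- and leaves carry pairwise distinct labels (so leaves ≅ leaf set L(T)).
  record Phylogenetic (t : Tree A) : Set where
    field
      branching    : ∀ (p : Pos t) ts → sub p ≡ node ts → 2 ≤ length ts
      distinctLeaf : ∀ (p q : Pos t) x → sub p ≡ leaf x → sub q ≡ leaf x → p ≡ q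

  SameLeaves : Tree A → Tree A → Set
  SameLeaves t s = ∀ x → (x ∈L t) ⇔ (x ∈L s)

  IsLca : ∀ (t : Tree A) → A → A → Pos t → Set
  IsLca t x y v = (x ∈L sub v) × (y ∈L sub v) ×
    (∀ (w : Pos t) → x ∈L sub w → y ∈L sub w → w ≼ v)

  _∈Lv_at_ : A × A → (t : Tree A) → Pos t → Set
  (x , y) ∈Lv t at v = IsLca t x y v

  -- T* refines T (same leaf set):  𝓗(T) ⊆ 𝓗(T*).
  Refines : Tree A → Tree A → Set
  Refines tstar t = SameLeaves t tstar ×
    (∀ (u : Pos t) → Σ (Pos tstar) λ u* → ∀ x → (x ∈L sub u) ⇔ (x ∈L sub u*))

-- Pick two leaves x₀ ≠ y₀ in different children of u*, so that u* = lca_{T*}(x₀, y₀),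
-- and let w = lca_T(x₀, y₀); w is inner since x₀ ≠ y₀. Every cluster of T is a cluster
-- of T*, so "the least cluster containing x and y" can be compared in both trees: the
-- T*-copy of L(T(w)) contains x₀, y₀, hence L(T*(u*)) ⊆ L(T(w)); and any cluster of T
-- containing x, y has a T*-copy containing x, y, hence containing L(T*(u*)) ∋ x₀, y₀.
-- Thus lca_{T*}(x, y) = u* forces lca_T(x, y) = w.
module Submission where

open import Defs
open import Data.Product using (Σ; ∃; _×_; _,_; proj₁; proj₂)
open import Data.List using ([]; _∷_; length; lookup)
open import Data.Fin using (Fin; zero; suc)
open import Data.Fin.Properties using (_≟_)
open import Data.Nat using (_≤_; s≤s)
open import Relation.Nullary using (yes; no; contradiction)
open import Relation.Binary.PropositionalEquality using (_≡_; _≢_; refl; sym; trans; subst)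
open import Function.Bundles using (_⇔_; Equivalence)
open Equivalence using (to; from)

module _ {A : Set} where

  Branching : Tree A → Set
  Branching t = ∀ (p : Pos t) ts → sub p ≡ node ts → 2 ≤ length ts

  UniquelyLabelled : Tree A → Set
  UniquelyLabelled t = ∀ (p q : Pos t) x → sub p ≡ leaf x → sub q ≡ leaf x → p ≡ q

  Separated : ∀ {t : Tree A} → Pos t → Pos t → Set
  Separated a b = ∀ w → w ≼ a → w ≼ b → w ≡ root

  infixr 25 _▸_

  _▸_ : ∀ {t : Tree A} (u : Pos t) → Pos (sub u) → Pos t
  root     ▸ q = q
  down i p ▸ q = down i (p ▸ q)

  sub-▸ : ∀ {t : Tree A} (u : Pos t) (q : Pos (sub u)) → sub (u ▸ q) ≡ sub q
  sub-▸ root       q = refl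
  sub-▸ (down i p) q = sub-▸ p q

  ≼-▸ : ∀ {t : Tree A} (u : Pos t) (q : Pos (sub u)) → u ≼ u ▸ q
  ≼-▸ root       q = root≼
  ≼-▸ (down i p) q = down≼ (≼-▸ p q)

  ▸-injective : ∀ {t : Tree A} (u : Pos t) {a b : Pos (sub u)} → u ▸ a ≡ u ▸ b → a ≡ b
  ▸-injective root       e = e
  ▸-injective (down i p) e = ▸-injective p (down-injective e)
    where
    down-injective : ∀ {ts} {i : Fin (length ts)} {x y : Pos (lookup ts i)} →
                     down {ts = ts} i x ≡ down i y → x ≡ y
    down-injective refl = refl

  ≼-▸-separated : ∀ {t : Tree A} (u : Pos t) {a b : Pos (sub u)} → Separated a b →
                  ∀ w → w ≼ u ▸ a → w ≼ u ▸ b → w ≼ u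
  ≼-▸-separated root       sep w h₁ h₂ with sep w h₁ h₂
  ... | refl = root≼
  ≼-▸-separated (down i u) sep .root root≼ _ = root≼
  ≼-▸-separated (down i u) sep _ (down≼ h₁) (down≼ h₂) = down≼ (≼-▸-separated u sep _ h₁ h₂)

  branching-sub : ∀ {t : Tree A} → Branching t → (u : Pos t) → Branching (sub u)
  branching-sub br u q ts e = br (u ▸ q) ts (trans (sub-▸ u q) e)

  ≼-embed : ∀ {t : Tree A} {v u : Pos t} → v ≼ u →
            (q : Pos (sub u)) → Σ (Pos (sub v)) λ r → sub r ≡ sub q
  ≼-embed (root≼ {p = u}) q = u ▸ q , sub-▸ u q
  ≼-embed (down≼ h)       q = ≼-embed h q

  ∈L-≼ : ∀ {t : Tree A} {v u : Pos t} {x : A} → v ≼ u → x ∈L sub u → x ∈L sub v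
  ∈L-≼ h (q , e) with ≼-embed h q
  ... | r , e′ = r , trans e′ e

  ≼leaf⇒∈L : ∀ {t : Tree A} {v p : Pos t} {x : A} → v ≼ p → sub p ≡ leaf x → x ∈L sub v
  ≼leaf⇒∈L h e = ∈L-≼ h (root , e)

  ∈L⇒≼leaf : ∀ {t : Tree A} → UniquelyLabelled t → {p : Pos t} {x : A} → sub p ≡ leaf x →
             (v : Pos t) → x ∈L sub v → v ≼ p
  ∈L⇒≼leaf uniq e v (q , e′) =
    subst (v ≼_) (uniq (v ▸ q) _ _ (trans (sub-▸ v q) e′) e) (≼-▸ v q)

  ∈L-leaf : ∀ {x z : A} → x ∈L leaf z → x ≡ z
  ∈L-leaf (root , refl) = refl

  distinct-leaves⇒node : ∀ (s : Tree A) {x y : A} → x ∈L s → y ∈L s → x ≢ y →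
                         ∃ λ ts → s ≡ node ts
  distinct-leaves⇒node (node ts) _  _  _   = ts , refl
  distinct-leaves⇒node (leaf z)  hx hy x≢y = contradiction (trans (∈L-leaf hx) (sym (∈L-leaf hy))) x≢y

  leaf-exists : ∀ (t : Tree A) → Branching t → ∃ λ x → x ∈L t
  leaf-exists (leaf x) br = x , root , refl
  leaf-exists (node []) br with br root [] refl
  ... | ()
  leaf-exists (node (t₀ ∷ ts)) br with leaf-exists t₀ (λ q → br (down zero q))
  ... | x , q , e = x , down zero q , e

  separated-leaves : ∀ {s : Tree A} ts → s ≡ node ts → Branching s →
    Σ A λ x → Σ A λ y → Σ (Pos s) λ a → Σ (Pos s) λ b →
    sub a ≡ leaf x × sub b ≡ leaf y × a ≢ b × Separated a b
  separated-leaves [] refl br with br root [] refl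
  ... | ()
  separated-leaves (_ ∷ []) refl br with br root _ refl
  ... | s≤s ()
  separated-leaves (t₀ ∷ t₁ ∷ _) refl br
    with leaf-exists t₀ (λ q → br (down zero q)) | leaf-exists t₁ (λ q → br (down (suc zero) q))
  ... | x , a , ea | y , b , eb = x , y , down zero a , down (suc zero) b , ea , eb , (λ ()) , sep
    where
    sep : Separated (down zero a) (down (suc zero) b)
    sep .root root≼ _ = refl

  inner-isLca : ∀ {t : Tree A} → Branching t → UniquelyLabelled t →
                (u : Pos t) → Inner u → Σ A λ x → Σ A λ y → x ≢ y × IsLca t x y u
  inner-isLca br uniq u (ts , e) with separated-leaves ts e (branching-sub br u)
  ... | x , y , a , b , ea , eb , a≢b , sep =
    x , y , x≢y , (a , ea) , (b , eb) , least
    where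
    ea′ : sub (u ▸ a) ≡ leaf x
    ea′ = trans (sub-▸ u a) ea
    eb′ : sub (u ▸ b) ≡ leaf y
    eb′ = trans (sub-▸ u b) eb
    x≢y : x ≢ y
    x≢y refl = a≢b (▸-injective u (uniq (u ▸ a) (u ▸ b) x ea′ eb′))
    least : ∀ w → x ∈L sub w → y ∈L sub w → w ≼ u
    least w hx hy = ≼-▸-separated u sep w (∈L⇒≼leaf uniq ea′ w hx) (∈L⇒≼leaf uniq eb′ w hy)

  infixl 25 _⊓_

  _⊓_ : ∀ {t : Tree A} → Pos t → Pos t → Pos t
  root     ⊓ q        = root
  down i p ⊓ root     = root
  down i p ⊓ down j q with i ≟ j
  ... | yes refl = down i (p ⊓ q)
  ... | no _     = root

  ⊓-≼ˡ : ∀ {t : Tree A} (p q : Pos t) → p ⊓ q ≼ p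
  ⊓-≼ˡ root       q          = root≼
  ⊓-≼ˡ (down i p) root       = root≼
  ⊓-≼ˡ (down i p) (down j q) with i ≟ j
  ... | yes refl = down≼ (⊓-≼ˡ p q)
  ... | no _     = root≼

  ⊓-≼ʳ : ∀ {t : Tree A} (p q : Pos t) → p ⊓ q ≼ q
  ⊓-≼ʳ root       q          = root≼
  ⊓-≼ʳ (down i p) root       = root≼
  ⊓-≼ʳ (down i p) (down j q) with i ≟ j
  ... | yes refl = down≼ (⊓-≼ʳ p q)
  ... | no _     = root≼

  ⊓-greatest : ∀ {t : Tree A} {w p q : Pos t} → w ≼ p → w ≼ q → w ≼ p ⊓ q
  ⊓-greatest root≼ _ = root≼
  ⊓-greatest (down≼ {i = i} h₁) (down≼ h₂) with i ≟ i
  ... | yes refl = down≼ (⊓-greatest h₁ h₂)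
  ... | no i≢i   = contradiction refl i≢i

  ⊓-isLca : ∀ {t : Tree A} → UniquelyLabelled t → (p q : Pos t) {x y : A} →
            sub p ≡ leaf x → sub q ≡ leaf y → IsLca t x y (p ⊓ q)
  ⊓-isLca uniq p q ep eq =
    ≼leaf⇒∈L (⊓-≼ˡ p q) ep , ≼leaf⇒∈L (⊓-≼ʳ p q) eq ,
    λ w hx hy → ⊓-greatest (∈L⇒≼leaf uniq {p = p} ep w hx) (∈L⇒≼leaf uniq {p = q} eq w hy)

  isLca-transfer : ∀ {T T* : Tree A} →
    (∀ (u : Pos T) → Σ (Pos T*) λ u* → ∀ x → (x ∈L sub u) ⇔ (x ∈L sub u*)) →
    ∀ {x₀ y₀} {u* : Pos T*} {w : Pos T} → IsLca T* x₀ y₀ u* → IsLca T x₀ y₀ w →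
    ∀ {x y} → IsLca T* x y u* → IsLca T x y w
  isLca-transfer {T} {T*} clusters {x₀} {y₀} {u*} {w}
                 (x₀∈u* , y₀∈u* , least*₀) (x₀∈w , y₀∈w , least₀)
                 {x} {y} (x∈u* , y∈u* , least*) =
    from (cw x) (∈L-≼ v*≼u* x∈u*) , from (cw y) (∈L-≼ v*≼u* y∈u*) , least
    where
    v* : Pos T*
    v* = proj₁ (clusters w)
    cw : ∀ z → (z ∈L sub w) ⇔ (z ∈L sub v*)
    cw = proj₂ (clusters w)
    v*≼u* : v* ≼ u*
    v*≼u* = least*₀ v* (to (cw x₀) x₀∈w) (to (cw y₀) y₀∈w)
    least : ∀ w′ → x ∈L sub w′ → y ∈L sub w′ → w′ ≼ w
    least w′ hx hy =
      least₀ w′ (from (c′ x₀) (∈L-≼ v′≼u* x₀∈u*)) (from (c′ y₀) (∈L-≼ v′≼u* y₀∈u*))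
      where
      v′ : Pos T*
      v′ = proj₁ (clusters w′)
      c′ : ∀ z → (z ∈L sub w′) ⇔ (z ∈L sub v′)
      c′ = proj₂ (clusters w′)
      v′≼u* : v′ ≼ u*
      v′≼u* = least* v′ (to (c′ x) hx) (to (c′ y) hy)

corollary1 : {A : Set} (T T* : Tree A) → Phylogenetic T → Phylogenetic T* →
    Refines T* T →
    ∀ (u* : Pos T*) → Inner u* →
    Σ (Pos T) λ w → Inner w × (∀ x y → (x , y) ∈Lv T* at u* → (x , y) ∈Lv T at w)
corollary1 T T* phT phT* (sameLeaves , clusters) u* inner*
  with inner-isLca (Phylogenetic.branching phT*) (Phylogenetic.distinctLeaf phT*) u* inner*
... | x₀ , y₀ , x₀≢y₀ , lca*@(x₀∈u* , y₀∈u* , _)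
  with from (sameLeaves x₀) (∈L-≼ (root≼ {p = u*}) x₀∈u*)
     | from (sameLeaves y₀) (∈L-≼ (root≼ {p = u*}) y₀∈u*)
... | p , ep | q , eq =
  p ⊓ q , distinct-leaves⇒node (sub (p ⊓ q)) x₀∈w y₀∈w x₀≢y₀ ,
  λ x y → isLca-transfer clusters lca* lca
  where
  lca : IsLca T x₀ y₀ (p ⊓ q)
  lca = ⊓-isLca (Phylogenetic.distinctLeaf phT) p q ep eq
  x₀∈w : x₀ ∈L sub (p ⊓ q)
  x₀∈w = proj₁ lca
  y₀∈w : y₀ ∈L sub (p ⊓ q)
  y₀∈w = proj₁ (proj₂ lca)
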